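{- Let $S=\{x_1,\dots,x_n\}$ be a gcd-closed set of distinct positive integers satisfying the condition $\mathcal G$. Let $x_m\in S$ with $G_S(x_m)=\{x_{m_1},x_{m_2},x_{m_3}\}$, let $x_{m_4}=(x_{m_1},x_{m_2},x_{m_3})$ and $x_{m_{ij}}=(x_{m_i},x_{m_j})$ for $1\le i<j\le 3$ (these all lie in $S$). Then for $1\le r\le n$, $$c_{rm}=\begin{cases}1,& r=m \text{ or } r=m_{ij}\ (1\le i<j\le 3),\\ -1,& r=m_i\ (1\le i\le 4),\\ 0,&\text{otherwise}.\end{cases}$$
   Context: $(x,y)$, $[x,y]$ denote gcd and lcm. $S$ is gcd closed if $(x_i,x_j)\in S$ for all $i,j$. For $x,y\in S$ with $x<y$, $x$ is a greatest-type divisor of $y$ in $S$ if $x\mid y$ and the conditions $x\mid d\mid y$, $d\in S$ imply $d\in\{x,y\}$; $G_S(y)$ is the set of greatest-type divisors of $y$ in $S$. For $x\in S$ with $|G_S(x)|\ge2$, two distinct $y_1,y_2\in G_S(x)$ satisfy the condition $\mathcal G$ if $[y_1,y_2]=x$ and $(y_1,y_2)\in G_S(y_1)\cap G_S(y_2)$; $x$ satisfies $\mathcal G$ if any two distinct elements of $G_S(x)$ do; $S$ satisfies $\mathcal G$ if every $x\in S$ has $|G_S(x)|\le1$ or satisfies $\mathcal G$. Indices $m_i$, $m_{ij}$ denote the indices in $S$ of the corresponding elements. $\mu$ is the Möbius function and $c_{rm}=\sum\mu(d)$, the sum over positive integers $d$ with $dx_r\mid x_m$ and $dx_r\nmid x_t$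 for every $x_t\in S$ with $x_t<x_m$. -}

module Defs where

open import Data.Nat using (ℕ; zero; suc; _<_; _≤_; _*_; _≤?_; _<?_)
open import Data.Nat.Divisibility using (_∣_; _∣?_)
open import Data.Nat.GCD using (gcd)
open import Data.Nat.LCM using (lcm)
open import Data.Nat.Primality using (prime?)
open import Data.Integer as ℤ using (ℤ; +_; -_)
open import Data.List using (List; upTo; filter; length; map; foldr; null)
open import Data.Fin using (Fin)
open import Data.Fin.Properties using (all?)
open import Data.Bool using (if_then_else_)
open import Data.Product using (Σ; _×_; ∃)
open import Data.Sum using (_⊎_)
open import Relation.Nullary using (¬_; does)
open import Relation.Nullary.Decidable using (_×-dec_; ¬?; _→-dec_)
open import Relation.Binary.PropositionalEquality using (_≡_)

-- Möbius function: μ(d) = 0 if k² ∣ d for some k ≥ 2, otherwise (-1)^(number of primes dividing d).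
-- (Value at 0 is irrelevant; it is never used.)
μ : ℕ → ℤ
μ d = if does (Data.List.Relation.Unary.Any.any? (λ k → (2 ≤? k) ×-dec ((k * k) ∣? d)) (upTo (suc d)))
      then + 0
      else (- (+ 1)) ℤ.^ length (filter (λ p → prime? p ×-dec (p ∣? d)) (upTo (suc d)))
  where import Data.List.Relation.Unary.Any

sumℤ : List ℤ → ℤ
sumℤ = foldr ℤ._+_ (+ 0)

module _ {n : ℕ} (x : Fin n → ℕ) where

  GcdClosed : Set
  GcdClosed = ∀ i j → ∃ λ k → x k ≡ gcd (x i) (x j)

  -- a is a greatest-type divisor of b in S (a, b assumed to be elements of S)
  IsGTD : ℕ → ℕ → Set
  IsGTD a b = a < b × a ∣ b × (∀ k → a ∣ x k → x k ∣ b → x k ≡ a ⊎ x k ≡ b)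

  PairG : ℕ → ℕ → ℕ → Set
  PairG z y₁ y₂ = lcm y₁ y₂ ≡ z × IsGTD (gcd y₁ y₂) y₁ × IsGTD (gcd y₁ y₂) y₂

  -- S satisfies 𝒢: every x ∈ S has |G_S(x)| ≤ 1 (then vacuous) or any two distinct
  -- elements of G_S(x) satisfy 𝒢.
  SatisfiesG : Set
  SatisfiesG = ∀ k i j → IsGTD (x i) (x k) → IsGTD (x j) (x k) → ¬ (x i ≡ x j)
               → PairG (x k) (x i) (x j)

  -- c_{rm} = Σ μ(d) over d ≥ 1 with d x_r ∣ x_m and d x_r ∤ x_t for all x_t ∈ S, x_t < x_m.
  -- (such d satisfy d ≤ x_m since x_m > 0, so summing over 1..x_m is exhaustive)
  c : Fin n → Fin n → ℤ
  c r m = sumℤ (map μ (filter P? (map suc (upTo (x m)))))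
    where
    P? = λ d → ((d * x r) ∣? x m) ×-dec
               all? (λ t → (x t <? x m) →-dec ¬? ((d * x r) ∣? x t))

-- Write Y₁, Y₂, Y₃ for the greatest-type divisors of x_m. By gcd-closedness every element of S
-- properly dividing x_m divides some Yᵢ, so the summation condition of c_{rm} reads
-- "d x_r ∣ x_m and d x_r ∤ Yᵢ for i = 1, 2, 3". Inclusion–exclusion over s ⊆ {1,2,3} turns c_{rm}
-- into Σ_s (-1)^|s| Σ_{d x_r ∣ g_s} μ(d), where g_s is the gcd of x_m and the Yᵢ with i ∈ s, and the
-- inner sum is [x_r = g_s]. Condition 𝒢 gives lcm(Yᵢ, Yₖ) = lcm(Yⱼ, Yₖ) = x_m, which forces
-- gcd(Yᵢ, Yⱼ) ∤ Yₖ; hence g_s divides Yᵢ exactly when i ∈ s, the eight g_s are distinct, and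
-- c_{rm} = (-1)^|s| if x_r = g_s and 0 if x_r is none of them.
module Submission where

open import Algebra.Bundles using (CommutativeMonoid)
open import Data.Bool using (Bool; true; false; if_then_else_; _∧_; not; T)
import Data.Bool.Properties as Bool
open import Data.Fin as Fin using (Fin)
import Data.Fin.Properties as Fin
open import Data.Fin.Patterns using (0F; 1F; 2F)
open import Data.Integer as ℤ using (ℤ; +_; -_; _+_; _-_; 0ℤ; 1ℤ)
import Data.Integer.Properties as ℤ
open import Data.List using (List; []; _∷_; map; filter; foldr; applyUpTo; upTo; length)
open import Data.List.Properties using (map-upTo)
open import Data.List.Relation.Unary.Any using (Any; any?)
open import Data.List.Relation.Unary.Any.Properties using (applyUpTo⁺; applyUpTo⁻)
import Data.List.Relation.Unary.All as All
open import Data.Nat as ℕ using (ℕ; zero; suc; _<_; _≤_; _∸_; s≤s; z≤n; _≟_; _≤?_; _<?_; NonZero)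
import Data.Nat.Properties as ℕ
open import Data.Nat.Coprimality using (Coprime; coprime-divisor)
open import Data.Nat.Divisibility
  using (_∣_; _∣?_; divides; _∣0; ∣-refl; ∣-trans; ∣-antisym; ∣⇒≤; >⇒∤; 0∣⇒≡0; m∣m*n; n∣m*n; ∣n⇒∣m*n;
         ∣m+n∣m⇒∣n; ∣m∣n⇒∣m+n; *-monoʳ-∣; *-monoˡ-∣; *-pres-∣; *-cancelˡ-∣; *-cancelʳ-∣)
open import Data.Nat.GCD using (gcd; gcd[m,n]∣m; gcd[m,n]∣n; gcd-greatest; gcd-assoc; c*gcd[m,n]≡gcd[cm,cn])
open import Data.Nat.Induction using (<-wellFounded)
open import Data.Nat.LCM using (lcm; lcm-least)
open import Data.Nat.Primality using (Prime; prime?; prime⇒nonZero; prime⇒nonTrivial; prime⇒irreducible; euclidsLemma)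
open import Data.Nat.Primality.Factorisation using (factorise)
open import Data.Product using (_×_; _,_; proj₁; proj₂; ∃)
open import Data.Sum using (_⊎_; inj₁; inj₂)
open import Data.Unit using (tt)
open import Data.Vec as Vec using (Vec; []; _∷_; lookup)
import Data.Vec.Properties as Vec
open import Function using (_∘_; id; case_of_)
open import Function.Bundles using (_⇔_; mk⇔)
open import Function.Definitions using (Injective)
open import Induction.WellFounded using (Acc; acc)
open import Relation.Binary.Definitions using (DecidableEquality)
import Relation.Binary.PropositionalEquality as ≡
open ≡ using (_≡_; _≢_; cong)
open import Relation.Nullary using (Dec; yes; no; does; ¬_)
open import Relation.Nullary.Decidable using (_×-dec_; _→-dec_; ¬?; T?; dec-true; dec-false; does-⇔)
open import Relation.Nullary.Negation using (contradiction)
open import Relation.Unary using (Pred; Decidable)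

open import Defs

-- Sums over initial segments of ℕ

module RangeSum {c ℓ} (M : CommutativeMonoid c ℓ) where

  open CommutativeMonoid M
    renaming (ε to 0#; refl to ≈-refl; sym to ≈-sym; trans to ≈-trans; reflexive to ≈-reflexive)
  open import Relation.Binary.Reasoning.Setoid setoid
  open import Algebra.Properties.CommutativeSemigroup commutativeSemigroup using (interchange)

  ∑ : ℕ → (ℕ → Carrier) → Carrier
  ∑ zero    f = 0#
  ∑ (suc n) f = f 0 ∙ ∑ n (f ∘ suc)

  infix 9 ∑
  syntax ∑ n (λ i → e) = ∑[ i < n ] e

  infixr 9 [_]·_
  [_]·_ : Bool → Carrier → Carrier
  [ b ]· v = if b then v else 0#

  listSum : List Carrier → Carrier
  listSum = foldr _∙_ 0#

  ∑-cong : ∀ n {f g} → (∀ i → f i ≈ g i) → ∑ n f ≈ ∑ n g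
  ∑-cong zero    f≈g = ≈-refl
  ∑-cong (suc n) f≈g = ∙-cong (f≈g 0) (∑-cong n (f≈g ∘ suc))

  ∑-zero : ∀ n {f} → (∀ {i} → i < n → f i ≈ 0#) → ∑ n f ≈ 0#
  ∑-zero zero    f≈0 = ≈-refl
  ∑-zero (suc n) f≈0 = ≈-trans (∙-cong (f≈0 (s≤s z≤n)) (∑-zero n (f≈0 ∘ s≤s))) (identityˡ 0#)

  ∑-distrib : ∀ n f g → ∑[ i < n ] (f i ∙ g i) ≈ ∑ n f ∙ ∑ n g
  ∑-distrib zero    f g = ≈-sym (identityˡ 0#)
  ∑-distrib (suc n) f g = ≈-trans (∙-congˡ (∑-distrib n (f ∘ suc) (g ∘ suc))) (interchange _ _ _ _)

  ∑-++ : ∀ a b f → ∑ (a ℕ.+ b) f ≈ ∑ a f ∙ ∑[ i < b ] f (a ℕ.+ i)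
  ∑-++ zero    b f = ≈-sym (identityˡ _)
  ∑-++ (suc a) b f = ≈-trans (∙-congˡ (∑-++ a b (f ∘ suc))) (≈-sym (assoc _ _ _))

  ∑-extend : ∀ {n₀ n f} → n₀ ≤ n → (∀ {i} → n₀ ≤ i → f i ≈ 0#) → ∑ n f ≈ ∑ n₀ f
  ∑-extend {n₀} {n} {f} n₀≤n f≈0 = begin
    ∑ n f                                  ≡⟨ cong (λ k → ∑ k f) (ℕ.m+[n∸m]≡n n₀≤n) ⟨
    ∑ (n₀ ℕ.+ (n ∸ n₀)) f                  ≈⟨ ∑-++ n₀ (n ∸ n₀) f ⟩
    ∑ n₀ f ∙ ∑[ i < n ∸ n₀ ] f (n₀ ℕ.+ i)  ≈⟨ ∙-congˡ (∑-zero (n ∸ n₀) (λ _ → f≈0 (ℕ.m≤m+n n₀ _))) ⟩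
    ∑ n₀ f ∙ 0#                            ≈⟨ identityʳ _ ⟩
    ∑ n₀ f                                 ∎

  []·-⇔ : ∀ {a b} {A : Set a} {B : Set b} (a? : Dec A) (b? : Dec B) {v} → A ⇔ B →
          [ does a? ]· v ≈ [ does b? ]· v
  []·-⇔ a? b? {v} A⇔B = ≈-reflexive (cong (λ b → [ b ]· v) (does-⇔ A⇔B a? b?))

  []·-split : ∀ b v → v ≈ [ not b ]· v ∙ [ b ]· v
  []·-split true  v = ≈-sym (identityˡ v)
  []·-split false v = ≈-sym (identityʳ v)

  ∑-single : ∀ {n p} v → p < n → ∑[ i < n ] [ does (i ≟ p) ]· v ≈ v
  ∑-single {suc n} {zero}  v _         = ≈-trans (∙-congˡ (∑-zero n (λ _ → ≈-refl))) (identityʳ v)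
  ∑-single {suc n} {suc p} v (s≤s p<n) = ≈-trans (identityˡ _) (∑-single v p<n)

  ∑-multiples : ∀ {p} N (g : ℕ → Carrier) → 0 < p →
                ∑[ d < N ℕ.* p ] [ does (p ∣? d) ]· g d ≈ ∑[ j < N ] g (j ℕ.* p)
  ∑-multiples zero g _ = ≈-refl
  ∑-multiples {p@(suc p′)} (suc N) g 0<p = begin
    ∑ (p ℕ.+ N ℕ.* p) F
      ≈⟨ ∑-++ p (N ℕ.* p) F ⟩
    (F 0 ∙ ∑[ i < p′ ] F (suc i)) ∙ ∑[ i < N ℕ.* p ] F (p ℕ.+ i)
      ≈⟨ ∙-cong (∙-cong F[0]≈g[0] (∑-zero p′ F≈0)) (∑-cong (N ℕ.* p) F-shift) ⟩
    (g 0 ∙ 0#) ∙ ∑[ i < N ℕ.* p ] [ does (p ∣? i) ]· g (p ℕ.+ i)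
      ≈⟨ ∙-cong (identityʳ (g 0)) (∑-multiples N (g ∘ (p ℕ.+_)) 0<p) ⟩
    g 0 ∙ ∑[ j < N ] g (p ℕ.+ j ℕ.* p)
      ∎
    where
    F : ℕ → Carrier
    F d = [ does (p ∣? d) ]· g d
    F[0]≈g[0] : F 0 ≈ g 0
    F[0]≈g[0] = ≈-reflexive (cong (λ b → [ b ]· g 0) (dec-true (p ∣? 0) (p ∣0)))
    F≈0 : ∀ {i} → i < p′ → F (suc i) ≈ 0#
    F≈0 {i} i<p′ = ≈-reflexive (cong (λ b → [ b ]· g (suc i))
                     (dec-false (p ∣? suc i) λ p∣ → ℕ.<⇒≱ (s≤s i<p′) (∣⇒≤ p∣)))
    F-shift : ∀ i → F (p ℕ.+ i) ≈ [ does (p ∣? i) ]· g (p ℕ.+ i)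
    F-shift i = []·-⇔ (p ∣? (p ℕ.+ i)) (p ∣? i)
                  (mk⇔ (λ p∣p+i → ∣m+n∣m⇒∣n p∣p+i ∣-refl) (∣m∣n⇒∣m+n ∣-refl))

  listSum-filter : ∀ {a p} {A : Set a} {P : Pred A p} (P? : Decidable P) f xs →
                   listSum (map f (filter P? xs)) ≈ listSum (map (λ y → [ does (P? y) ]· f y) xs)
  listSum-filter P? f []       = ≈-refl
  listSum-filter P? f (y ∷ ys) with does (P? y)
  ... | true  = ∙-congˡ (listSum-filter P? f ys)
  ... | false = ≈-trans (listSum-filter P? f ys) (≈-sym (identityˡ _))

  listSum-applyUpTo : ∀ (f : ℕ → Carrier) g n → listSum (map f (applyUpTo g n)) ≡ ∑[ i < n ] f (g i)
  listSum-applyUpTo f g zero    = ≡.refl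
  listSum-applyUpTo f g (suc n) = cong (f (g 0) ∙_) (listSum-applyUpTo f (g ∘ suc) n)

-- The count of prime divisors in the definition of μ, written the same way.
ω : ℕ → ℕ
ω d = length (filter (λ q → prime? q ×-dec (q ∣? d)) (upTo (suc d)))

module _ where
  open RangeSum ℕ.+-0-commutativeMonoid

  length-filter≡listSum : ∀ {a p} {A : Set a} {P : Pred A p} (P? : Decidable P) xs →
                          length (filter P? xs) ≡ listSum (map (λ y → [ does (P? y) ]· 1) xs)
  length-filter≡listSum P? []       = ≡.refl
  length-filter≡listSum P? (y ∷ ys) with does (P? y)
  ... | true  = cong suc (length-filter≡listSum P? ys)
  ... | false = length-filter≡listSum P? ys

  ω-*-prime : ∀ {p d} .{{_ : NonZero d}} → Prime p → ¬ p ∣ d → ω (p ℕ.* d) ≡ suc (ω d)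
  ω-*-prime {p} {d} pp p∤d = begin
    ω (p ℕ.* d)                                              ≡⟨ ω≡∑χ (p ℕ.* d) ⟩
    ∑ (suc (p ℕ.* d)) (χ (p ℕ.* d))                          ≡⟨ ∑-cong (suc (p ℕ.* d)) χ-*-prime ⟩
    ∑[ q < suc (p ℕ.* d) ] (χ d q ℕ.+ [ does (q ≟ p) ]· 1)
      ≡⟨ ∑-distrib (suc (p ℕ.* d)) (χ d) (λ q → [ does (q ≟ p) ]· 1) ⟩
    ∑ (suc (p ℕ.* d)) (χ d) ℕ.+ ∑[ q < suc (p ℕ.* d) ] [ does (q ≟ p) ]· 1
      ≡⟨ ≡.cong₂ ℕ._+_ (∑-extend (s≤s (ℕ.m≤n*m d p)) χ[d]≡0) (∑-single 1 (s≤s (ℕ.m≤m*n p d))) ⟩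
    ∑ (suc d) (χ d) ℕ.+ 1                                    ≡⟨ ℕ.+-comm _ 1 ⟩
    suc (∑ (suc d) (χ d))                                    ≡⟨ cong suc (ω≡∑χ d) ⟨
    suc (ω d)                                                ∎
    where
    open ≡.≡-Reasoning
    instance _ = prime⇒nonZero pp
    χ : ℕ → ℕ → ℕ
    χ n q = [ does (prime? q ×-dec (q ∣? n)) ]· 1
    ω≡∑χ : ∀ n → ω n ≡ ∑ (suc n) (χ n)
    ω≡∑χ n = ≡.trans (length-filter≡listSum (λ q → prime? q ×-dec (q ∣? n)) (upTo (suc n)))
                     (listSum-applyUpTo (χ n) id (suc n))
    χ[d]≡0 : ∀ {q} → suc d ≤ q → χ d q ≡ 0
    χ[d]≡0 {q} d<q = cong ([_]· 1)
      (dec-false (prime? q ×-dec (q ∣? d)) λ (_ , q∣d) → ℕ.<⇒≱ d<q (∣⇒≤ q∣d))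
    χ-*-prime : ∀ q → χ (p ℕ.* d) q ≡ χ d q ℕ.+ [ does (q ≟ p) ]· 1
    χ-*-prime q with q ≟ p
    ... | yes ≡.refl
      rewrite dec-true (prime? p ×-dec (p ∣? p ℕ.* d)) (pp , m∣m*n d)
            | dec-false (prime? p ×-dec (p ∣? d)) (p∤d ∘ proj₂)
            | dec-true (p ≟ p) ≡.refl = ≡.refl
    ... | no q≢p rewrite dec-false (q ≟ p) q≢p =
      ≡.trans ([]·-⇔ (prime? q ×-dec (q ∣? p ℕ.* d)) (prime? q ×-dec (q ∣? d)) (mk⇔ to from))
              (≡.sym (ℕ.+-identityʳ _))
      where
      to : Prime q × q ∣ p ℕ.* d → Prime q × q ∣ d
      to (pq , q∣pd) with euclidsLemma p d pq q∣pd
      ... | inj₂ q∣d = pq , q∣d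
      ... | inj₁ q∣p with prime⇒irreducible pp q∣p
      ...   | inj₁ ≡.refl = contradiction pq λ ()
      ...   | inj₂ q≡p    = contradiction q≡p q≢p
      from : Prime q × q ∣ d → Prime q × q ∣ p ℕ.* d
      from (pq , q∣d) = pq , ∣n⇒∣m*n p q∣d

-- Alternating sums over subsets, and inclusion–exclusion

open RangeSum ℤ.+-0-commutativeMonoid

∑-neg : ∀ n f → ∑[ i < n ] (- f i) ≡ - ∑ n f
∑-neg zero    f = ≡.refl
∑-neg (suc n) f = ≡.trans (cong (λ z → - f 0 + z) (∑-neg n (f ∘ suc))) (≡.sym (ℤ.neg-distrib-+ (f 0) _))

[]·-neg : ∀ b v → [ b ]· (- v) ≡ - [ b ]· v
[]·-neg true  v = ≡.refl
[]·-neg false v = ≡.refl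

[]·-zero : ∀ b → [ b ]· 0ℤ ≡ 0ℤ
[]·-zero true  = ≡.refl
[]·-zero false = ≡.refl

alternatingSum : ∀ {k} → (Vec Bool k → ℤ) → ℤ
alternatingSum {zero}  f = f []
alternatingSum {suc k} f = alternatingSum (f ∘ (false ∷_)) - alternatingSum (f ∘ (true ∷_))

alternatingSum-cong : ∀ {k} {f g : Vec Bool k → ℤ} → (∀ s → f s ≡ g s) → alternatingSum f ≡ alternatingSum g
alternatingSum-cong {zero}  f≡g = f≡g []
alternatingSum-cong {suc k} f≡g =
  ≡.cong₂ _-_ (alternatingSum-cong (f≡g ∘ (false ∷_))) (alternatingSum-cong (f≡g ∘ (true ∷_)))

alternatingSum-zero : ∀ k → alternatingSum {k} (λ _ → 0ℤ) ≡ 0ℤ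
alternatingSum-zero zero    = ≡.refl
alternatingSum-zero (suc k) = ≡.cong₂ _-_ (alternatingSum-zero k) (alternatingSum-zero k)

∑-alternatingSum : ∀ {k} N (f : Vec Bool k → ℕ → ℤ) →
                   ∑[ d < N ] alternatingSum (λ s → f s d) ≡ alternatingSum (λ s → ∑ N (f s))
∑-alternatingSum {zero}  N f = ≡.refl
∑-alternatingSum {suc k} N f = begin
  ∑[ d < N ] (A d - B d)            ≡⟨ ∑-distrib N A (λ d → - B d) ⟩
  ∑ N A + ∑[ d < N ] (- B d)        ≡⟨ cong (λ z → ∑ N A + z) (∑-neg N B) ⟩
  ∑ N A - ∑ N B                     ≡⟨ ≡.cong₂ _-_ (∑-alternatingSum N (f ∘ (false ∷_)))
                                                   (∑-alternatingSum N (f ∘ (true ∷_))) ⟩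
  alternatingSum (λ s → ∑ N (f s))  ∎
  where
  open ≡.≡-Reasoning
  A B : ℕ → ℤ
  A d = alternatingSum (λ s → f (false ∷ s) d)
  B d = alternatingSum (λ s → f (true ∷ s) d)

allIn : ∀ {k} → Vec Bool k → Vec Bool k → Bool → Bool
allIn []          []      a = a
allIn (false ∷ s) (_ ∷ B) a = allIn s B a
allIn (true ∷ s)  (b ∷ B) a = b ∧ allIn s B a

noneOf : ∀ {k} → Vec Bool k → Bool → Bool
noneOf []      a = a
noneOf (b ∷ B) a = not b ∧ noneOf B a

inclusion-exclusion : ∀ {k} (B : Vec Bool k) a v →
                      [ noneOf B a ]· v ≡ alternatingSum (λ s → [ allIn s B a ]· v)
inclusion-exclusion []               a v = ≡.refl
inclusion-exclusion {suc k} (false ∷ B) a v = begin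
  [ noneOf B a ]· v                  ≡⟨ inclusion-exclusion B a v ⟩
  A                                  ≡⟨ ℤ.+-identityʳ A ⟨
  A - 0ℤ                             ≡⟨ cong (λ z → A - z) (alternatingSum-zero k) ⟨
  A - alternatingSum {k} (λ _ → 0ℤ)  ∎
  where
  open ≡.≡-Reasoning
  A = alternatingSum (λ s → [ allIn s B a ]· v)
inclusion-exclusion (true ∷ B) a v = ≡.sym (ℤ.+-inverseʳ (alternatingSum (λ s → [ allIn s B a ]· v)))

-- The Möbius function

SquareFree : ℕ → Set
SquareFree d = ∀ k → 2 ≤ k → ¬ k ℕ.* k ∣ d

HasSquareFactor : ℕ → Set
HasSquareFactor d = Any (λ k → 2 ≤ k × k ℕ.* k ∣ d) (upTo (suc d))

hasSquareFactor? : ∀ d → Dec (HasSquareFactor d)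
hasSquareFactor? d = any? (λ k → (2 ≤? k) ×-dec ((k ℕ.* k) ∣? d)) (upTo (suc d))

hasSquareFactor : ∀ {d k} .{{_ : NonZero d}} → 2 ≤ k → k ℕ.* k ∣ d → HasSquareFactor d
hasSquareFactor {k = k@(suc _)} 2≤k k²∣d =
  applyUpTo⁺ id (2≤k , k²∣d) (s≤s (ℕ.≤-trans (ℕ.m≤m*n k k) (∣⇒≤ k²∣d)))

μ-squareful : ∀ {d k} .{{_ : NonZero d}} → 2 ≤ k → k ℕ.* k ∣ d → μ d ≡ 0ℤ
μ-squareful {d} 2≤k k²∣d = cong (λ b → if b then 0ℤ else (- 1ℤ) ℤ.^ ω d)
  (dec-true (hasSquareFactor? d) (hasSquareFactor 2≤k k²∣d))

μ-squarefree : ∀ {d} → SquareFree d → μ d ≡ (- 1ℤ) ℤ.^ ω d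
μ-squarefree {d} sf = cong (λ b → if b then 0ℤ else (- 1ℤ) ℤ.^ ω d)
  (dec-false (hasSquareFactor? d) λ sq → let (k , _ , 2≤k , k²∣d) = applyUpTo⁻ id sq in sf k 2≤k k²∣d)

squareful-or-squarefree : ∀ d .{{_ : NonZero d}} → (∃ λ k → 2 ≤ k × k ℕ.* k ∣ d) ⊎ SquareFree d
squareful-or-squarefree d with hasSquareFactor? d
... | yes sq  = let (k , _ , k-square) = applyUpTo⁻ id sq in inj₁ (k , k-square)
... | no ¬sq  = inj₂ λ k 2≤k k²∣d → ¬sq (hasSquareFactor 2≤k k²∣d)

squarefree-*-prime : ∀ {p d} → Prime p → ¬ p ∣ d → SquareFree d → SquareFree (p ℕ.* d)
squarefree-*-prime {p} pp p∤d sf k 2≤k k²∣pd with p ∣? k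
... | yes p∣k = p∤d (*-cancelˡ-∣ p (∣-trans (*-pres-∣ p∣k p∣k) k²∣pd))
  where instance _ = prime⇒nonZero pp
... | no p∤k = sf k 2≤k (coprime-divisor k²⊥p k²∣pd)
  where
  k²⊥p : Coprime (k ℕ.* k) p
  k²⊥p (e∣k² , e∣p) with prime⇒irreducible pp e∣p
  ... | inj₁ e≡1    = e≡1
  ... | inj₂ ≡.refl with euclidsLemma k k pp e∣k²
  ...   | inj₁ p∣k = contradiction p∣k p∤k
  ...   | inj₂ p∣k = contradiction p∣k p∤k

μ-*-prime-∣ : ∀ {p d} .{{_ : NonZero d}} → Prime p → p ∣ d → μ (p ℕ.* d) ≡ 0ℤ
μ-*-prime-∣ {p} {d} pp p∣d = μ-squareful (ℕ.nonTrivial⇒n>1 p) (*-monoʳ-∣ p p∣d)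
  where instance
    _ = prime⇒nonZero pp
    _ = prime⇒nonTrivial pp
    _ = ℕ.m*n≢0 p d

μ-*-prime-∤ : ∀ {p d} .{{_ : NonZero d}} → Prime p → ¬ p ∣ d → μ (p ℕ.* d) ≡ - μ d
μ-*-prime-∤ {p} {d} pp p∤d with squareful-or-squarefree d
... | inj₁ (k , 2≤k , k²∣d) =
  ≡.trans (μ-squareful 2≤k (∣n⇒∣m*n p k²∣d)) (cong -_ (≡.sym (μ-squareful 2≤k k²∣d)))
  where instance _ = ℕ.m*n≢0 p d {{prime⇒nonZero pp}}
... | inj₂ sf = begin
  μ (p ℕ.* d)                ≡⟨ μ-squarefree (squarefree-*-prime pp p∤d sf) ⟩
  (- 1ℤ) ℤ.^ ω (p ℕ.* d)     ≡⟨ cong ((- 1ℤ) ℤ.^_) (ω-*-prime pp p∤d) ⟩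
  - 1ℤ ℤ.* (- 1ℤ) ℤ.^ ω d    ≡⟨ ℤ.-1*i≡-i _ ⟩
  - ((- 1ℤ) ℤ.^ ω d)         ≡⟨ cong -_ (μ-squarefree sf) ⟨
  - μ d                      ∎
  where open ≡.≡-Reasoning

prime-factor : ∀ {K} → 1 < K → ∃ λ p → Prime p × p ∣ K
prime-factor {K} 1<K with factorise K {{ℕ.>-nonZero (ℕ.<-trans (s≤s z≤n) 1<K)}}
... | record { factors = [] ; isFactorisation = K≡1 } = contradiction K≡1 (ℕ.>⇒≢ 1<K)
... | record { factors = p ∷ ps ; isFactorisation = K≡p*ps ; factorsPrime = pp All.∷ _ } =
  p , pp , ≡.subst (p ∣_) (≡.sym K≡p*ps) (m∣m*n _)

*-prime-∣ : ∀ {p j K} → Prime p → ¬ p ∣ j → p ∣ K → j ∣ K → j ℕ.* p ∣ K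
*-prime-∣ {p} {j} pp p∤j p∣K (divides q ≡.refl) with euclidsLemma q j pp p∣K
... | inj₁ p∣q = ≡.subst (j ℕ.* p ∣_) (ℕ.*-comm j q) (*-monoʳ-∣ j p∣q)
... | inj₂ p∣j = contradiction p∣j p∤j

divisor-term-*-prime : ∀ {p K} .{{_ : NonZero K}} → Prime p → p ∣ K → ∀ j →
  [ does (j ℕ.* p ∣? K) ]· μ (j ℕ.* p) ≡ - [ not (does (p ∣? j)) ]· [ does (j ∣? K) ]· μ j
divisor-term-*-prime {p} {K} pp p∣K zero rewrite dec-true (p ∣? 0) (p ∣0) =
  cong ([_]· μ 0) (dec-false (0 ∣? K) λ 0∣K → ℕ.≢-nonZero⁻¹ K (0∣⇒≡0 0∣K))
divisor-term-*-prime {p} {K} pp p∣K j@(suc _) with p ∣? j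
... | yes p∣j =
  ≡.trans (cong ([ does (j ℕ.* p ∣? K) ]·_) (≡.trans (cong μ (ℕ.*-comm j p)) (μ-*-prime-∣ pp p∣j)))
          ([]·-zero _)
... | no p∤j = begin
  [ does (j ℕ.* p ∣? K) ]· μ (j ℕ.* p)
    ≡⟨ cong ([ does (j ℕ.* p ∣? K) ]·_) (≡.trans (cong μ (ℕ.*-comm j p)) (μ-*-prime-∤ pp p∤j)) ⟩
  [ does (j ℕ.* p ∣? K) ]· (- μ j)
    ≡⟨ []·-⇔ (j ℕ.* p ∣? K) (j ∣? K) (mk⇔ (∣-trans (m∣m*n p)) (*-prime-∣ pp p∤j p∣K)) ⟩
  [ does (j ∣? K) ]· (- μ j)
    ≡⟨ []·-neg (does (j ∣? K)) (μ j) ⟩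
  - [ does (j ∣? K) ]· μ j
    ∎
  where open ≡.≡-Reasoning

∑-μ-divisors : ∀ {N} K .{{_ : NonZero K}} → K < N → ∑[ d < N ] [ does (d ∣? K) ]· μ d ≡ [ does (K ≟ 1) ]· 1ℤ
-- After truncation to d < 2 the sum evaluates to μ 1 = + 1.
∑-μ-divisors 1 1<N = ∑-extend 1<N λ {d} 2≤d →
  cong ([_]· μ d) (dec-false (d ∣? 1) λ d∣1 → ℕ.<⇒≱ 2≤d (∣⇒≤ d∣1))
-- For a prime p ∣ K, by divisor-term-*-prime the terms with p ∣ d cancel those with p ∤ d.
∑-μ-divisors {N} K@(suc (suc _)) K<N with prime-factor {K} (s≤s (s≤s z≤n))
... | p , pp , p∣K = begin
  ∑ N t                                        ≡⟨ ∑-extend K<N t≡0 ⟩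
  ∑ (suc K) t                                  ≡⟨ ∑-extend K<N₁ t≡0 ⟨
  ∑ N₁ t                                       ≡⟨ ∑-cong N₁ (λ d → []·-split (does (p ∣? d)) (t d)) ⟩
  ∑[ d < N₁ ] (h d + [ does (p ∣? d) ]· t d)   ≡⟨ ∑-distrib N₁ h (λ d → [ does (p ∣? d) ]· t d) ⟩
  ∑ N₁ h + ∑[ d < N₁ ] [ does (p ∣? d) ]· t d
    ≡⟨ ≡.cong₂ _+_ (∑-extend K<N₁ h≡0) (∑-multiples (suc K) t (ℕ.>-nonZero⁻¹ p)) ⟩
  ∑ (suc K) h + ∑[ j < suc K ] t (j ℕ.* p)
    ≡⟨ cong (λ z → ∑ (suc K) h + z) (≡.trans (∑-cong (suc K) (divisor-term-*-prime pp p∣K)) (∑-neg (suc K) h)) ⟩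
  ∑ (suc K) h - ∑ (suc K) h                    ≡⟨ ℤ.+-inverseʳ (∑ (suc K) h) ⟩
  0ℤ                                           ∎
  where
  open ≡.≡-Reasoning
  instance _ = prime⇒nonZero pp
  N₁ = suc K ℕ.* p
  K<N₁ : suc K ≤ N₁
  K<N₁ = ℕ.m≤m*n (suc K) p
  t h : ℕ → ℤ
  t d = [ does (d ∣? K) ]· μ d
  h d = [ not (does (p ∣? d)) ]· t d
  t≡0 : ∀ {d} → suc K ≤ d → t d ≡ 0ℤ
  t≡0 {d} K<d = cong ([_]· μ d) (dec-false (d ∣? K) λ d∣K → ℕ.<⇒≱ K<d (∣⇒≤ d∣K))
  h≡0 : ∀ {d} → suc K ≤ d → h d ≡ 0ℤ
  h≡0 {d} K<d = ≡.trans (cong ([ not (does (p ∣? d)) ]·_) (t≡0 K<d)) ([]·-zero _)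

∑-μ-multiples : ∀ {a N} L .{{_ : NonZero a}} .{{_ : NonZero N}} → N ≤ L →
                ∑[ d < suc L ] [ does (d ℕ.* a ∣? N) ]· μ d ≡ [ does (a ≟ N) ]· 1ℤ
∑-μ-multiples {a} {N} L N≤L with a ∣? N
... | no a∤N =
  ≡.trans (∑-zero (suc L) λ {d} _ → cong ([_]· μ d) (dec-false (d ℕ.* a ∣? N) (a∤N ∘ ∣-trans (n∣m*n d))))
          (cong ([_]· 1ℤ) (≡.sym (dec-false (a ≟ N) λ { ≡.refl → a∤N ∣-refl })))
... | yes (divides zero N≡0) = contradiction N≡0 (ℕ.≢-nonZero⁻¹ N)
... | yes (divides K@(suc _) N≡K*a) = begin
  ∑[ d < suc L ] [ does (d ℕ.* a ∣? N) ]· μ d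
    ≡⟨ ∑-cong (suc L) (λ d → []·-⇔ (d ℕ.* a ∣? N) (d ∣? K) {μ d} (mk⇔ cancel extend)) ⟩
  ∑[ d < suc L ] [ does (d ∣? K) ]· μ d        ≡⟨ ∑-μ-divisors K (s≤s (ℕ.≤-trans (∣⇒≤ K∣N) N≤L)) ⟩
  [ does (K ≟ 1) ]· 1ℤ                         ≡⟨ []·-⇔ (K ≟ 1) (a ≟ N) (mk⇔ K≡1⇒a≡N a≡N⇒K≡1) ⟩
  [ does (a ≟ N) ]· 1ℤ                         ∎
  where
  open ≡.≡-Reasoning
  K∣N : K ∣ N
  K∣N = divides a (≡.trans N≡K*a (ℕ.*-comm K a))
  cancel : ∀ {d} → d ℕ.* a ∣ N → d ∣ K
  cancel da∣N = *-cancelʳ-∣ a (≡.subst (_ ∣_) N≡K*a da∣N)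
  extend : ∀ {d} → d ∣ K → d ℕ.* a ∣ N
  extend d∣K = ≡.subst (_ ∣_) (≡.sym N≡K*a) (*-monoˡ-∣ a d∣K)
  K≡1⇒a≡N : K ≡ 1 → a ≡ N
  K≡1⇒a≡N ≡.refl = ≡.sym (≡.trans N≡K*a (ℕ.*-identityˡ a))
  a≡N⇒K≡1 : a ≡ N → K ≡ 1
  a≡N⇒K≡1 a≡N = ℕ.*-cancelʳ-≡ K 1 a (begin
    K ℕ.* a  ≡⟨ N≡K*a ⟨
    N        ≡⟨ a≡N ⟨
    a        ≡⟨ ℕ.*-identityˡ a ⟨
    1 ℕ.* a  ∎)

∣gcd⇔ : ∀ {d m n} → d ∣ gcd m n ⇔ (d ∣ m × d ∣ n)
∣gcd⇔ {d} {m} {n} = mk⇔ (λ d∣g → ∣-trans d∣g (gcd[m,n]∣m m n) , ∣-trans d∣g (gcd[m,n]∣n m n))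
                         (λ (d∣m , d∣n) → gcd-greatest d∣m d∣n)

m∣n⇒gcd[m,n]≡m : ∀ {m n} → m ∣ n → gcd m n ≡ m
m∣n⇒gcd[m,n]≡m {m} {n} m∣n = ∣-antisym (gcd[m,n]∣m m n) (gcd-greatest ∣-refl m∣n)

-- With o = w · gcd m n, lcm m o ∣ w m and lcm n o ∣ w n, while gcd (w m) (w n) = o.
gcd[m,n]∣o⇒gcd[lcm[m,o],lcm[n,o]]∣o : ∀ {m n o} → gcd m n ∣ o → gcd (lcm m o) (lcm n o) ∣ o
gcd[m,n]∣o⇒gcd[lcm[m,o],lcm[n,o]]∣o {m} {n} (divides w ≡.refl) =
  ≡.subst (gcd (lcm m o) (lcm n o) ∣_) (≡.sym (c*gcd[m,n]≡gcd[cm,cn] w m n))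
    (gcd-greatest (∣-trans (gcd[m,n]∣m (lcm m o) (lcm n o)) (lcm∣w* m (gcd[m,n]∣m m n)))
                  (∣-trans (gcd[m,n]∣n (lcm m o) (lcm n o)) (lcm∣w* n (gcd[m,n]∣n m n))))
  where
  o = w ℕ.* gcd m n
  lcm∣w* : ∀ a → gcd m n ∣ a → lcm a o ∣ w ℕ.* a
  lcm∣w* a g∣a = lcm-least (n∣m*n w) (*-monoʳ-∣ w g∣a)

lcm≡lcm⇒gcd∤ : ∀ {a b c l} .{{_ : NonZero c}} → lcm a c ≡ l → lcm b c ≡ l → c < l → ¬ gcd a b ∣ c
lcm≡lcm⇒gcd∤ {a} {b} {c} {l} ac≡l bc≡l c<l gcd∣c =
  >⇒∤ c<l (≡.subst (_∣ c) gcd[l,l]≡l (gcd[m,n]∣o⇒gcd[lcm[m,o],lcm[n,o]]∣o {a} {b} gcd∣c))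
  where
  gcd[l,l]≡l : gcd (lcm a c) (lcm b c) ≡ l
  gcd[l,l]≡l = ≡.trans (≡.cong₂ gcd ac≡l bc≡l) (m∣n⇒gcd[m,n]≡m ∣-refl)

meet : ∀ {k} → Vec Bool k → Vec ℕ k → ℕ → ℕ
meet []          []       a = a
meet (false ∷ s) (_ ∷ ys) a = meet s ys a
meet (true ∷ s)  (y ∷ ys) a = gcd y (meet s ys a)

divisorPattern : ∀ {k} → ℕ → Vec ℕ k → Vec Bool k
divisorPattern d = Vec.map (λ y → does (d ∣? y))

does-∣-meet : ∀ {k} d (s : Vec Bool k) ys a →
              does (d ∣? meet s ys a) ≡ allIn s (divisorPattern d ys) (does (d ∣? a))
does-∣-meet d []          []       a = ≡.refl
does-∣-meet d (false ∷ s) (y ∷ ys) a = does-∣-meet d s ys a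
does-∣-meet d (true ∷ s)  (y ∷ ys) a =
  ≡.trans (does-⇔ ∣gcd⇔ (d ∣? gcd y (meet s ys a)) ((d ∣? y) ×-dec (d ∣? meet s ys a)))
          (cong (does (d ∣? y) ∧_) (does-∣-meet d s ys a))

∣-meet : ∀ {k d a} (s : Vec Bool k) ys → d ∣ a → (∀ i → T (lookup s i) → d ∣ lookup ys i) → d ∣ meet s ys a
∣-meet []          []       d∣a d∣ys = d∣a
∣-meet (false ∷ s) (y ∷ ys) d∣a d∣ys = ∣-meet s ys d∣a (d∣ys ∘ Fin.suc)
∣-meet (true ∷ s)  (y ∷ ys) d∣a d∣ys = gcd-greatest (d∣ys Fin.zero _) (∣-meet s ys d∣a (d∣ys ∘ Fin.suc))

meet-∣ : ∀ {k a} (s : Vec Bool k) ys i → T (lookup s i) → meet s ys a ∣ lookup ys i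
meet-∣ (true ∷ s)  (y ∷ ys) Fin.zero    _  = gcd[m,n]∣m y _
meet-∣ (true ∷ s)  (y ∷ ys) (Fin.suc i) sᵢ = ∣-trans (gcd[m,n]∣n y _) (meet-∣ s ys i sᵢ)
meet-∣ (false ∷ s) (y ∷ ys) (Fin.suc i) sᵢ = meet-∣ s ys i sᵢ

meet-∣-base : ∀ {k a} (s : Vec Bool k) ys → meet s ys a ∣ a
meet-∣-base []          []       = ∣-refl
meet-∣-base (false ∷ s) (y ∷ ys) = meet-∣-base s ys
meet-∣-base (true ∷ s)  (y ∷ ys) = ∣-trans (gcd[m,n]∣n y _) (meet-∣-base s ys)

-- Greatest-type divisors in a finite set

module _ {n} (x : Fin n → ℕ) (x>0 : ∀ i → 0 < x i) where

  gtd-above : ∀ {m} k → x k ∣ x m → x k < x m → ∃ λ j → IsGTD x (x j) (x m) × x k ∣ x j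
  gtd-above {m} k = go k (<-wellFounded (x m ∸ x k))
    where
    Between : Fin n → Fin n → Set
    Between k j = x k ∣ x j × x j ∣ x m × x j ≢ x k × x j ≢ x m
    between? : ∀ k j → Dec (Between k j)
    between? k j = (x k ∣? x j) ×-dec (x j ∣? x m) ×-dec ¬? (x j ≟ x k) ×-dec ¬? (x j ≟ x m)
    go : ∀ k → Acc _<_ (x m ∸ x k) → x k ∣ x m → x k < x m → ∃ λ j → IsGTD x (x j) (x m) × x k ∣ x j
    go k (acc rec) k∣m k<m with Fin.any? (between? k)
    ... | yes (j , k∣j , j∣m , j≢k , j≢m) =
      let j<m = ℕ.≤∧≢⇒< (∣⇒≤ {{ℕ.>-nonZero (x>0 m)}} j∣m) j≢m
          k<j = ℕ.≤∧≢⇒< (∣⇒≤ {{ℕ.>-nonZero (x>0 j)}} k∣j) (j≢k ∘ ≡.sym)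
          (i , i-gtd , j∣i) = go j (rec (ℕ.∸-monoʳ-< k<j (ℕ.<⇒≤ j<m))) j∣m j<m
      in i , i-gtd , ∣-trans k∣j j∣i
    ... | no nothing-between = k , (k<m , k∣m , maximal) , ∣-refl
      where
      maximal : ∀ j → x k ∣ x j → x j ∣ x m → x j ≡ x k ⊎ x j ≡ x m
      maximal j k∣j j∣m with x j ≟ x k | x j ≟ x m
      ... | yes j≡k | _       = inj₁ j≡k
      ... | no _    | yes j≡m = inj₂ j≡m
      ... | no j≢k  | no j≢m  = contradiction (j , k∣j , j∣m , j≢k , j≢m) nothing-between

  gtd-above-common-divisor : GcdClosed x → ∀ {d m t} → d ∣ x m → d ∣ x t → x t < x m →
                             ∃ λ j → IsGTD x (x j) (x m) × d ∣ x j
  gtd-above-common-divisor gcd-closed {d} {m} {t} d∣m d∣t t<m =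
    let (i , i≡gcd) = gcd-closed t m
        i∣m = ≡.subst (_∣ x m) (≡.sym i≡gcd) (gcd[m,n]∣n (x t) (x m))
        i≤t = ≡.subst (_≤ x t) (≡.sym i≡gcd) (∣⇒≤ {{ℕ.>-nonZero (x>0 t)}} (gcd[m,n]∣m (x t) (x m)))
        (j , j-gtd , i∣j) = gtd-above i i∣m (ℕ.≤-<-trans i≤t t<m)
    in j , j-gtd , ∣-trans (≡.subst (d ∣_) (≡.sym i≡gcd) (gcd-greatest d∣t d∣m)) i∣j

module ThreeGreatestTypeDivisors
  {n} (x : Fin n → ℕ) (x-injective : Injective _≡_ _≡_ x) (x>0 : ∀ i → 0 < x i)
  (gcd-closed : GcdClosed x) (condition-𝒢 : SatisfiesG x)
  (m m₁ m₂ m₃ : Fin n) (m₁≢m₂ : m₁ ≢ m₂) (m₁≢m₃ : m₁ ≢ m₃) (m₂≢m₃ : m₂ ≢ m₃)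
  (G[xₘ] : ∀ k → (IsGTD x (x k) (x m) → k ≡ m₁ ⊎ k ≡ m₂ ⊎ k ≡ m₃)
               × (k ≡ m₁ ⊎ k ≡ m₂ ⊎ k ≡ m₃ → IsGTD x (x k) (x m)))
  (m₄ m₁₂ m₁₃ m₂₃ : Fin n)
  (x[m₄] : x m₄ ≡ gcd (gcd (x m₁) (x m₂)) (x m₃))
  (x[m₁₂] : x m₁₂ ≡ gcd (x m₁) (x m₂))
  (x[m₁₃] : x m₁₃ ≡ gcd (x m₁) (x m₃))
  (x[m₂₃] : x m₂₃ ≡ gcd (x m₂) (x m₃))
  where

  M : ℕ
  M = x m

  Ys : Vec ℕ 3
  Ys = x m₁ ∷ x m₂ ∷ x m₃ ∷ []

  gtd : ∀ i → IsGTD x (lookup Ys i) M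
  gtd 0F = proj₂ (G[xₘ] m₁) (inj₁ ≡.refl)
  gtd 1F = proj₂ (G[xₘ] m₂) (inj₂ (inj₁ ≡.refl))
  gtd 2F = proj₂ (G[xₘ] m₃) (inj₂ (inj₂ ≡.refl))

  Y<M : ∀ i → lookup Ys i < M
  Y<M i = proj₁ (gtd i)

  Y∣M : ∀ i → lookup Ys i ∣ M
  Y∣M i = proj₁ (proj₂ (gtd i))

  lcm≡M : ∀ {k l} → IsGTD x (x k) M → IsGTD x (x l) M → k ≢ l → lcm (x k) (x l) ≡ M
  lcm≡M {k} {l} k-gtd l-gtd k≢l = proj₁ (condition-𝒢 m k l k-gtd l-gtd (k≢l ∘ x-injective))

  gcdOfOthers : Fin 3 → ℕ
  gcdOfOthers 0F = gcd (x m₂) (x m₃)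
  gcdOfOthers 1F = gcd (x m₁) (x m₃)
  gcdOfOthers 2F = gcd (x m₁) (x m₂)

  gcdOfOthers-∣ : ∀ i j → j ≢ i → gcdOfOthers i ∣ lookup Ys j
  gcdOfOthers-∣ 0F 0F 0≢0 = contradiction ≡.refl 0≢0
  gcdOfOthers-∣ 0F 1F _   = gcd[m,n]∣m (x m₂) (x m₃)
  gcdOfOthers-∣ 0F 2F _   = gcd[m,n]∣n (x m₂) (x m₃)
  gcdOfOthers-∣ 1F 0F _   = gcd[m,n]∣m (x m₁) (x m₃)
  gcdOfOthers-∣ 1F 1F 1≢1 = contradiction ≡.refl 1≢1
  gcdOfOthers-∣ 1F 2F _   = gcd[m,n]∣n (x m₁) (x m₃)
  gcdOfOthers-∣ 2F 0F _   = gcd[m,n]∣m (x m₁) (x m₂)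
  gcdOfOthers-∣ 2F 1F _   = gcd[m,n]∣n (x m₁) (x m₂)
  gcdOfOthers-∣ 2F 2F 2≢2 = contradiction ≡.refl 2≢2

  gcdOfOthers-∤ : ∀ i → ¬ gcdOfOthers i ∣ lookup Ys i
  gcdOfOthers-∤ 0F = lcm≡lcm⇒gcd∤ {x m₂} {x m₃} {{ℕ.>-nonZero (x>0 m₁)}}
    (lcm≡M (gtd 1F) (gtd 0F) (m₁≢m₂ ∘ ≡.sym)) (lcm≡M (gtd 2F) (gtd 0F) (m₁≢m₃ ∘ ≡.sym)) (Y<M 0F)
  gcdOfOthers-∤ 1F = lcm≡lcm⇒gcd∤ {x m₁} {x m₃} {{ℕ.>-nonZero (x>0 m₂)}}
    (lcm≡M (gtd 0F) (gtd 1F) m₁≢m₂) (lcm≡M (gtd 2F) (gtd 1F) (m₂≢m₃ ∘ ≡.sym)) (Y<M 1F)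
  gcdOfOthers-∤ 2F = lcm≡lcm⇒gcd∤ {x m₁} {x m₂} {{ℕ.>-nonZero (x>0 m₃)}}
    (lcm≡M (gtd 0F) (gtd 2F) m₁≢m₃) (lcm≡M (gtd 1F) (gtd 2F) m₂≢m₃) (Y<M 2F)

  gcdOfOthers∣M : ∀ i → gcdOfOthers i ∣ M
  gcdOfOthers∣M 0F = ∣-trans (gcdOfOthers-∣ 0F 1F λ ()) (Y∣M 1F)
  gcdOfOthers∣M 1F = ∣-trans (gcdOfOthers-∣ 1F 0F λ ()) (Y∣M 0F)
  gcdOfOthers∣M 2F = ∣-trans (gcdOfOthers-∣ 2F 0F λ ()) (Y∣M 0F)

  -- s ⊆ {1, 2, 3} names the gcd of x_m and the x_{mᵢ} with i ∈ s; vertexIndex s is its index in S.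
  vertexIndex : Vec Bool 3 → Fin n
  vertexIndex (false ∷ false ∷ false ∷ []) = m
  vertexIndex (true  ∷ false ∷ false ∷ []) = m₁
  vertexIndex (false ∷ true  ∷ false ∷ []) = m₂
  vertexIndex (false ∷ false ∷ true  ∷ []) = m₃
  vertexIndex (true  ∷ true  ∷ false ∷ []) = m₁₂
  vertexIndex (true  ∷ false ∷ true  ∷ []) = m₁₃
  vertexIndex (false ∷ true  ∷ true  ∷ []) = m₂₃
  vertexIndex (true  ∷ true  ∷ true  ∷ []) = m₄

  vertex : Vec Bool 3 → ℕ
  vertex s = x (vertexIndex s)

  gcd[Y,M]≡Y : ∀ i → gcd (lookup Ys i) M ≡ lookup Ys i
  gcd[Y,M]≡Y i = m∣n⇒gcd[m,n]≡m (Y∣M i)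

  vertex≡meet : ∀ s → vertex s ≡ meet s Ys M
  vertex≡meet (false ∷ false ∷ false ∷ []) = ≡.refl
  vertex≡meet (true  ∷ false ∷ false ∷ []) = ≡.sym (gcd[Y,M]≡Y 0F)
  vertex≡meet (false ∷ true  ∷ false ∷ []) = ≡.sym (gcd[Y,M]≡Y 1F)
  vertex≡meet (false ∷ false ∷ true  ∷ []) = ≡.sym (gcd[Y,M]≡Y 2F)
  vertex≡meet (true  ∷ true  ∷ false ∷ []) = ≡.trans x[m₁₂] (cong (gcd (x m₁)) (≡.sym (gcd[Y,M]≡Y 1F)))
  vertex≡meet (true  ∷ false ∷ true  ∷ []) = ≡.trans x[m₁₃] (cong (gcd (x m₁)) (≡.sym (gcd[Y,M]≡Y 2F)))
  vertex≡meet (false ∷ true  ∷ true  ∷ []) = ≡.trans x[m₂₃] (cong (gcd (x m₂)) (≡.sym (gcd[Y,M]≡Y 2F)))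
  vertex≡meet (true  ∷ true  ∷ true  ∷ []) =
    ≡.trans x[m₄] (≡.trans (gcd-assoc (x m₁) (x m₂) (x m₃))
                           (cong (gcd (x m₁) ∘ gcd (x m₂)) (≡.sym (gcd[Y,M]≡Y 2F))))

  vertex∣M : ∀ s → vertex s ∣ M
  vertex∣M s = ≡.subst (_∣ M) (≡.sym (vertex≡meet s)) (meet-∣-base s Ys)

  vertex∣Y⇔ : ∀ s i → vertex s ∣ lookup Ys i ⇔ T (lookup s i)
  vertex∣Y⇔ s i = mk⇔ to (λ sᵢ → ≡.subst (_∣ lookup Ys i) (≡.sym (vertex≡meet s)) (meet-∣ s Ys i sᵢ))
    where
    to : vertex s ∣ lookup Ys i → T (lookup s i)
    to v∣Yᵢ with lookup s i in sᵢ≡b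
    ... | true  = tt
    ... | false = contradiction (∣-trans others∣vertex v∣Yᵢ) (gcdOfOthers-∤ i)
      where
      others∣vertex : gcdOfOthers i ∣ vertex s
      others∣vertex = ≡.subst (gcdOfOthers i ∣_) (≡.sym (vertex≡meet s))
        (∣-meet s Ys (gcdOfOthers∣M i) λ j sⱼ → gcdOfOthers-∣ i j λ { ≡.refl → ≡.subst T sᵢ≡b sⱼ })

  divisorPattern-vertex : ∀ s → divisorPattern (vertex s) Ys ≡ s
  divisorPattern-vertex s =
    ≡.trans (Vec.tabulate-cong λ i → does-⇔ (vertex∣Y⇔ s i) (vertex s ∣? lookup Ys i) (T? (lookup s i)))
            (Vec.tabulate∘lookup s)

  vertex-injective : ∀ {s t} → vertex s ≡ vertex t → s ≡ t
  vertex-injective {s} {t} vs≡vt = begin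
    s                           ≡⟨ divisorPattern-vertex s ⟨
    divisorPattern (vertex s) Ys ≡⟨ cong (λ v → divisorPattern v Ys) vs≡vt ⟩
    divisorPattern (vertex t) Ys ≡⟨ divisorPattern-vertex t ⟩
    t                           ∎
    where open ≡.≡-Reasoning

  ∣-below⇒∣Y : ∀ {k t} → k ∣ M → k ∣ x t → x t < M → ∃ λ i → k ∣ lookup Ys i
  ∣-below⇒∣Y k∣M k∣t t<M with gtd-above-common-divisor x x>0 gcd-closed k∣M k∣t t<M
  ... | j , j-gtd , k∣j with proj₁ (G[xₘ] j) j-gtd
  ...   | inj₁ ≡.refl        = 0F , k∣j
  ...   | inj₂ (inj₁ ≡.refl) = 1F , k∣j
  ...   | inj₂ (inj₂ ≡.refl) = 2F , k∣j

  Admissible : Fin n → ℕ → Set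
  Admissible r d = d ℕ.* x r ∣ M × ∀ t → x t < M → ¬ d ℕ.* x r ∣ x t

  admissible? : ∀ r d → Dec (Admissible r d)
  admissible? r d = ((d ℕ.* x r) ∣? M) ×-dec Fin.all? (λ t → (x t <? M) →-dec ¬? ((d ℕ.* x r) ∣? x t))

  admissible⇔ : ∀ {k} → (k ∣ M × ∀ t → x t < M → ¬ k ∣ x t) ⇔
                        (¬ k ∣ x m₁ × ¬ k ∣ x m₂ × ¬ k ∣ x m₃ × k ∣ M)
  admissible⇔ = mk⇔ (λ (k∣M , avoids) → avoids m₁ (Y<M 0F) , avoids m₂ (Y<M 1F) , avoids m₃ (Y<M 2F) , k∣M)
    λ (k∤Y₁ , k∤Y₂ , k∤Y₃ , k∣M) → k∣M , λ t t<M k∣t → case ∣-below⇒∣Y k∣M k∣t t<M of λ where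
      (0F , k∣Y₁) → k∤Y₁ k∣Y₁
      (1F , k∣Y₂) → k∤Y₂ k∣Y₂
      (2F , k∣Y₃) → k∤Y₃ k∣Y₃

  does-∣-vertex : ∀ k s → does (k ∣? vertex s) ≡ allIn s (divisorPattern k Ys) (does (k ∣? M))
  does-∣-vertex k s = ≡.trans (cong (λ v → does (k ∣? v)) (vertex≡meet s)) (does-∣-meet k s Ys M)

  admissible-term : ∀ r d → [ does (admissible? r d) ]· μ d ≡
                            alternatingSum (λ s → [ does (d ℕ.* x r ∣? vertex s) ]· μ d)
  admissible-term r d = begin
    [ does (admissible? r d) ]· μ d
      ≡⟨ []·-⇔ (admissible? r d) (¬? (k ∣? x m₁) ×-dec ¬? (k ∣? x m₂) ×-dec ¬? (k ∣? x m₃) ×-dec (k ∣? M))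
               admissible⇔ ⟩
    [ noneOf (divisorPattern k Ys) (does (k ∣? M)) ]· μ d
      ≡⟨ inclusion-exclusion (divisorPattern k Ys) (does (k ∣? M)) (μ d) ⟩
    alternatingSum (λ s → [ allIn s (divisorPattern k Ys) (does (k ∣? M)) ]· μ d)
      ≡⟨ alternatingSum-cong (λ s → cong ([_]· μ d) (≡.sym (does-∣-vertex k s))) ⟩
    alternatingSum (λ s → [ does (k ∣? vertex s) ]· μ d)
      ∎
    where
    open ≡.≡-Reasoning
    k = d ℕ.* x r

  c≡alternatingSum : ∀ r → c x r m ≡ alternatingSum (λ s → [ does (x r ≟ vertex s) ]· 1ℤ)
  c≡alternatingSum r = begin
    c x r m
      ≡⟨ listSum-filter (admissible? r) μ (map suc (upTo M)) ⟩
    listSum (map term (map suc (upTo M)))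
      ≡⟨ cong (listSum ∘ map term) (map-upTo suc M) ⟩
    listSum (map term (applyUpTo suc M))
      ≡⟨ listSum-applyUpTo term suc M ⟩
    ∑[ i < M ] term (suc i)
      ≡⟨ ≡.trans (cong (_+ ∑[ i < M ] term (suc i)) term[0]≡0) (ℤ.+-identityˡ _) ⟨
    ∑[ d < suc M ] term d
      ≡⟨ ∑-cong (suc M) (admissible-term r) ⟩
    ∑[ d < suc M ] alternatingSum (λ s → [ does (d ℕ.* x r ∣? vertex s) ]· μ d)
      ≡⟨ ∑-alternatingSum (suc M) (λ s d → [ does (d ℕ.* x r ∣? vertex s) ]· μ d) ⟩
    alternatingSum (λ s → ∑[ d < suc M ] [ does (d ℕ.* x r ∣? vertex s) ]· μ d)
      ≡⟨ alternatingSum-cong (λ s → ∑-μ-multiples M {{nonZero r}} {{nonZero (vertexIndex s)}} (vertex≤M s)) ⟩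
    alternatingSum (λ s → [ does (x r ≟ vertex s) ]· 1ℤ)
      ∎
    where
    open ≡.≡-Reasoning
    nonZero : ∀ i → NonZero (x i)
    nonZero i = ℕ.>-nonZero (x>0 i)
    term : ℕ → ℤ
    term d = [ does (admissible? r d) ]· μ d
    term[0]≡0 : term 0 ≡ 0ℤ
    term[0]≡0 = cong ([_]· μ 0)
      (dec-false (admissible? r 0) λ (0∣M , _) → ℕ.≢-nonZero⁻¹ M {{nonZero m}} (0∣⇒≡0 0∣M))
    vertex≤M : ∀ s → vertex s ≤ M
    vertex≤M s = ∣⇒≤ {{nonZero m}} (vertex∣M s)

  _≟ᵥ_ : DecidableEquality (Vec Bool 3)
  _≟ᵥ_ = Vec.≡-dec Bool._≟_

  c-at-vertex : ∀ p → c x (vertexIndex p) m ≡ alternatingSum (λ s → [ does (p ≟ᵥ s) ]· 1ℤ)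
  c-at-vertex p = ≡.trans (c≡alternatingSum (vertexIndex p))
    (alternatingSum-cong λ s → []·-⇔ (vertex p ≟ vertex s) (p ≟ᵥ s) {1ℤ} (mk⇔ vertex-injective (cong vertex)))

  c-off-vertices : ∀ r → (∀ s → r ≢ vertexIndex s) → c x r m ≡ 0ℤ
  c-off-vertices r r∉ = ≡.trans (c≡alternatingSum r)
    (≡.trans (alternatingSum-cong λ s → cong ([_]· 1ℤ) (dec-false (x r ≟ vertex s) (r∉ s ∘ x-injective)))
             (alternatingSum-zero 3))

  c≡+1 : ∀ r → r ≡ m ⊎ r ≡ m₁₂ ⊎ r ≡ m₁₃ ⊎ r ≡ m₂₃ → c x r m ≡ + 1
  c≡+1 r (inj₁ ≡.refl)               = c-at-vertex (false ∷ false ∷ false ∷ [])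
  c≡+1 r (inj₂ (inj₁ ≡.refl))        = c-at-vertex (true  ∷ true  ∷ false ∷ [])
  c≡+1 r (inj₂ (inj₂ (inj₁ ≡.refl))) = c-at-vertex (true  ∷ false ∷ true  ∷ [])
  c≡+1 r (inj₂ (inj₂ (inj₂ ≡.refl))) = c-at-vertex (false ∷ true  ∷ true  ∷ [])

  c≡-1 : ∀ r → r ≡ m₁ ⊎ r ≡ m₂ ⊎ r ≡ m₃ ⊎ r ≡ m₄ → c x r m ≡ - (+ 1)
  c≡-1 r (inj₁ ≡.refl)               = c-at-vertex (true  ∷ false ∷ false ∷ [])
  c≡-1 r (inj₂ (inj₁ ≡.refl))        = c-at-vertex (false ∷ true  ∷ false ∷ [])
  c≡-1 r (inj₂ (inj₂ (inj₁ ≡.refl))) = c-at-vertex (false ∷ false ∷ true  ∷ [])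
  c≡-1 r (inj₂ (inj₂ (inj₂ ≡.refl))) = c-at-vertex (true  ∷ true  ∷ true  ∷ [])

  c≡0 : ∀ r → ¬ (r ≡ m ⊎ r ≡ m₁₂ ⊎ r ≡ m₁₃ ⊎ r ≡ m₂₃ ⊎ r ≡ m₁ ⊎ r ≡ m₂ ⊎ r ≡ m₃ ⊎ r ≡ m₄) →
        c x r m ≡ + 0
  c≡0 r r∉ = c-off-vertices r λ where
    (false ∷ false ∷ false ∷ []) r≡ → r∉ (inj₁ r≡)
    (true  ∷ true  ∷ false ∷ []) r≡ → r∉ (inj₂ (inj₁ r≡))
    (true  ∷ false ∷ true  ∷ []) r≡ → r∉ (inj₂ (inj₂ (inj₁ r≡)))
    (false ∷ true  ∷ true  ∷ []) r≡ → r∉ (inj₂ (inj₂ (inj₂ (inj₁ r≡))))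
    (true  ∷ false ∷ false ∷ []) r≡ → r∉ (inj₂ (inj₂ (inj₂ (inj₂ (inj₁ r≡)))))
    (false ∷ true  ∷ false ∷ []) r≡ → r∉ (inj₂ (inj₂ (inj₂ (inj₂ (inj₂ (inj₁ r≡))))))
    (false ∷ false ∷ true  ∷ []) r≡ → r∉ (inj₂ (inj₂ (inj₂ (inj₂ (inj₂ (inj₂ (inj₁ r≡)))))))
    (true  ∷ true  ∷ true  ∷ []) r≡ → r∉ (inj₂ (inj₂ (inj₂ (inj₂ (inj₂ (inj₂ (inj₂ r≡)))))))

lemma2p7 : (n : ℕ) (x : Fin n → ℕ)
    → Injective _≡_ _≡_ x
    → (∀ i → 0 < x i)
    → GcdClosed x
    → SatisfiesG x
    → (m m₁ m₂ m₃ : Fin n)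
    → ¬ (m₁ ≡ m₂) → ¬ (m₁ ≡ m₃) → ¬ (m₂ ≡ m₃)
    → (∀ k → (IsGTD x (x k) (x m) → k ≡ m₁ ⊎ k ≡ m₂ ⊎ k ≡ m₃)
           × (k ≡ m₁ ⊎ k ≡ m₂ ⊎ k ≡ m₃ → IsGTD x (x k) (x m)))
    → (m₄ m₁₂ m₁₃ m₂₃ : Fin n)
    → x m₄ ≡ gcd (gcd (x m₁) (x m₂)) (x m₃)
    → x m₁₂ ≡ gcd (x m₁) (x m₂)
    → x m₁₃ ≡ gcd (x m₁) (x m₃)
    → x m₂₃ ≡ gcd (x m₂) (x m₃)
    → (r : Fin n)
    → ((r ≡ m ⊎ r ≡ m₁₂ ⊎ r ≡ m₁₃ ⊎ r ≡ m₂₃) → c x r m ≡ + 1)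
      × ((r ≡ m₁ ⊎ r ≡ m₂ ⊎ r ≡ m₃ ⊎ r ≡ m₄) → c x r m ≡ - (+ 1))
      × (¬ (r ≡ m ⊎ r ≡ m₁₂ ⊎ r ≡ m₁₃ ⊎ r ≡ m₂₃ ⊎ r ≡ m₁ ⊎ r ≡ m₂ ⊎ r ≡ m₃ ⊎ r ≡ m₄)
         → c x r m ≡ + 0)
lemma2p7 n x x-injective x>0 gcd-closed condition-𝒢 m m₁ m₂ m₃ m₁≢m₂ m₁≢m₃ m₂≢m₃ G[xₘ]
         m₄ m₁₂ m₁₃ m₂₃ x[m₄] x[m₁₂] x[m₁₃] x[m₂₃] r =
  c≡+1 r , c≡-1 r , c≡0 r
  where
  open ThreeGreatestTypeDivisors x x-injective x>0 gcd-closed condition-𝒢 m m₁ m₂ m₃ m₁≢m₂ m₁≢m₃ m₂≢m₃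
                                 G[xₘ] m₄ m₁₂ m₁₃ m₂₃ x[m₄] x[m₁₂] x[m₁₃] x[m₂₃]
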